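{- Suppose $\Gamma\vdash r:A$ and $\Gamma\vdash\varsigma$. Then $\Gamma|_{\mathbb A}\vdash r\,\varsigma_{\mathbb X}:A$.
   Context: Modal type system. Disjoint countably infinite sets $\mathbb A$ (atoms) and $\mathbb X$ (unknowns). Types: $A::=o\mid \mathbb N\mid A\to A\mid \Box A$. Constants $C$ with types $\mathrm{type}(C)$. Terms: $r::=C\mid a\mid X_@\mid \lambda a{:}A.r\mid rr\mid \Box r\mid \mathrm{letbox}\ X=s\ \mathrm{in}\ r$ (up to $\alpha$-equivalence). Free atoms: $\mathrm{fa}(C)=\mathrm{fa}(X_@)=\emptyset$, $\mathrm{fa}(a)=\{a\}$, $\mathrm{fa}(\lambda a{:}A.r)=\mathrm{fa}(r)\setminus\{a\}$, $\mathrm{fa}(rs)=\mathrm{fa}(r)\cup\mathrm{fa}(s)$, $\mathrm{fa}(\Box r)=\mathrm{fa}(r)$, $\mathrm{fa}(\mathrm{letbox}\ X=s\ \mathrm{in}\ r)=\mathrm{fa}(r)\cup\mathrm{fa}(s)$; free unknowns $\mathrm{fv}$ analogously with $\mathrm{fv}(X_@)=\{X\}$ and letbox binding $X$. Typing contexts: finite partial functions from $\mathbb A\cup\mathbb X$ to types; $\Gamma|_{\mathbb A}$ is $\Gamma$ restricted to atoms. Rules: (Hyp) $\Gamma,a{:}A\vdash a:A$; (Const) $\Gamma\vdash C:\mathrm{type}(C)$; (${\to}$I) from $\Gamma,a{:}A\vdash r:B$ infer $\Gamma\vdash\lambda a{:}A.r:A\to B$; (${\to}$E) from $\Gamma\vdash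 r':A\to B$, $\Gamma\vdash r:A$ infer $\Gamma\vdash r'r:B$; ($\Box$I) from $\Gamma\vdash r:A$, $\mathrm{fa}(r)=\emptyset$ infer $\Gamma\vdash\Box r:\Box A$; ($\Box$E) from $\Gamma\vdash s:\Box A$, $\Gamma,X{:}\Box A\vdash r:B$ infer $\Gamma\vdash\mathrm{letbox}\ X=s\ \mathrm{in}\ r:B$; (Ext) $\Gamma,X{:}\Box A\vdash X_@:A$. Unknowns-substitution $\theta$: finite partial map from $\mathbb X$ to terms of the form $\Box r'$ with $\mathrm{fa}(r')=\emptyset$; action structural (capture-avoiding) with $X_@\theta=s'$ if $\theta(X)=\Box s'$ and $X_@\theta=X_@$ if $X\notin\mathrm{dom}\theta$. Denotation of types: $[\![o]\!]=\{\top,\bot\}$, $[\![\mathbb N]\!]=\mathbb N$, $[\![A\to B]\!]$ = all functions $[\![A]\!]\to[\![B]\!]$, $[\![\Box A]\!]=\{\Box r\mid\emptyset\vdash\Box r:\Box A\}\times[\![A]\!]$, with $\mathrm{hd}$ the first projection. A valuation $\varsigma$ is a finite partial function on $\mathbb A\cup\mathbb X$; $\Gamma\vdash\varsigma$ means $\mathrm{dom}\Gamma=\mathrm{dom}\varsigma$, $\varsigma(a)\in[\![\Gamma(a)]\!]$ for atoms, and $\varsigma(X)\in[\![\Box A]\!]$ whenever $\Gamma(X)=\Box A$. $\varsigma_{\mathbb X}$ is the unknowns-substitution with $\varsigma_{\mathbb X}(X)=\mathrm{hd}(\varsigma(X))$ for $X\in\mathrm{dom}\varsigma$ and undefined otherwise.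 -}

module Defs where

open import Data.Nat using (ℕ; zero; suc)
open import Data.Fin using (Fin; zero; suc)
open import Data.Bool using (Bool)
open import Data.List using (List; []; _∷_; _++_)
open import Data.Vec using (Vec; []; _∷_; lookup)
open import Data.Product using (Σ; _×_; proj₁)
open import Function using (id)
open import Relation.Binary.PropositionalEquality using (_≡_)

data Ty : Set where
  o   : Ty
  N   : Ty
  _⇒_ : Ty → Ty → Ty
  □   : Ty → Ty

infixr 5 _⇒_

-- Terms up to α-equivalence, as well-scoped de Bruijn terms.  Atoms and unknowns are disjoint name spaces.
--   con c        ~  C
--   atm j        ~  a            (atom)
--   unk i        ~  X_@          (unknown)
--   lam A r      ~  λ a:A. r     (binds atom 0 in r)
--   app r s      ~  r s
--   box r        ~  □ r
--   letbox s r   ~  letbox X = s in r   (binds unknown 0 in r)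

data Term (C : Set) (u a : ℕ) : Set where
  con    : C → Term C u a
  atm    : Fin a → Term C u a
  unk    : Fin u → Term C u a
  lam    : Ty → Term C u (suc a) → Term C u a
  app    : Term C u a → Term C u a → Term C u a
  box    : Term C u a → Term C u a
  letbox : Term C u a → Term C (suc u) a → Term C u a

-- free atoms fa(r), as a list (fa(r) = ∅ iff the list is [])
strip : ∀ {a} → List (Fin (suc a)) → List (Fin a)
strip []            = []
strip (zero  ∷ xs)  = strip xs
strip (suc j ∷ xs)  = j ∷ strip xs

fa : ∀ {C u a} → Term C u a → List (Fin a)
fa (con c)      = []
fa (atm j)      = j ∷ []
fa (unk i)      = []
fa (lam A r)    = strip (fa r)
fa (app r s)    = fa r ++ fa s
fa (box r)      = fa r
fa (letbox s r) = fa r ++ fa s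

lift : ∀ {n m} → (Fin n → Fin m) → Fin (suc n) → Fin (suc m)
lift f zero    = zero
lift f (suc i) = suc (f i)

ren : ∀ {C u u' a a'} → (Fin u → Fin u') → (Fin a → Fin a') →
      Term C u a → Term C u' a'
ren f g (con c)      = con c
ren f g (atm j)      = atm (g j)
ren f g (unk i)      = unk (f i)
ren f g (lam A r)    = lam A (ren f (lift g) r)
ren f g (app r s)    = app (ren f g r) (ren f g s)
ren f g (box r)      = box (ren f g r)
ren f g (letbox s r) = letbox (ren f g s) (ren (lift f) g r)

noAtoms : ∀ {a} → Fin 0 → Fin a
noAtoms ()

-- An unknowns-substitution from u unknowns into terms with m unknowns:
-- θ i = r'  represents  θ(X_i) = □ r'  with fa(r') = ∅ (r' has no atoms
-- in scope).  Unknowns not to be substituted are mapped to  unk _ .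
Subst : Set → ℕ → ℕ → Set
Subst C u m = Fin u → Term C m 0

liftS : ∀ {C u m} → Subst C u m → Subst C (suc u) (suc m)
liftS θ zero    = unk zero
liftS θ (suc i) = ren suc id (θ i)

-- action r θ  (capture-avoiding; X_@ θ = s' where θ(X) = □ s')
_⟨_⟩ : ∀ {C u m a} → Term C u a → Subst C u m → Term C m a
con c      ⟨ θ ⟩ = con c
atm j      ⟨ θ ⟩ = atm j
unk i      ⟨ θ ⟩ = ren id noAtoms (θ i)
lam A r    ⟨ θ ⟩ = lam A (r ⟨ θ ⟩)
app r s    ⟨ θ ⟩ = app (r ⟨ θ ⟩) (s ⟨ θ ⟩)
box r      ⟨ θ ⟩ = box (r ⟨ θ ⟩)
letbox s r ⟨ θ ⟩ = letbox (s ⟨ θ ⟩) (r ⟨ liftS θ ⟩)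

-- Typing.  A context Γ is split into its unknown part Δ and its atom part
-- Γa; Δ i = A means  X_i : □ A  (unknowns only ever get box types).
-- Γ|_𝔸 is then ([] , Γa).

module _ {C : Set} (type : C → Ty) where

  data _⨾_⊢_∶_ : ∀ {u a} → Vec Ty u → Vec Ty a → Term C u a → Ty → Set where
    hyp    : ∀ {u a} {Δ : Vec Ty u} {Γ : Vec Ty a} (j : Fin a) →
             Δ ⨾ Γ ⊢ atm j ∶ lookup Γ j
    const  : ∀ {u a} {Δ : Vec Ty u} {Γ : Vec Ty a} (c : C) →
             Δ ⨾ Γ ⊢ con c ∶ type c
    →I     : ∀ {u a} {Δ : Vec Ty u} {Γ : Vec Ty a} {A B r} →
             Δ ⨾ (A ∷ Γ) ⊢ r ∶ B → Δ ⨾ Γ ⊢ lam A r ∶ (A ⇒ B)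
    →E     : ∀ {u a} {Δ : Vec Ty u} {Γ : Vec Ty a} {A B r' r} →
             Δ ⨾ Γ ⊢ r' ∶ (A ⇒ B) → Δ ⨾ Γ ⊢ r ∶ A → Δ ⨾ Γ ⊢ app r' r ∶ B
    □I     : ∀ {u a} {Δ : Vec Ty u} {Γ : Vec Ty a} {A r} →
             Δ ⨾ Γ ⊢ r ∶ A → fa r ≡ [] → Δ ⨾ Γ ⊢ box r ∶ □ A
    □E     : ∀ {u a} {Δ : Vec Ty u} {Γ : Vec Ty a} {A B s r} →
             Δ ⨾ Γ ⊢ s ∶ □ A → (A ∷ Δ) ⨾ Γ ⊢ r ∶ B →
             Δ ⨾ Γ ⊢ letbox s r ∶ B
    ext    : ∀ {u a} {Δ : Vec Ty u} {Γ : Vec Ty a} (i : Fin u) →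
             Δ ⨾ Γ ⊢ unk i ∶ lookup Δ i

  -- closed box terms of type □A:  { □ r | ∅ ⊢ □ r : □ A }, represented by r
  ClosedBox : Ty → Set
  ClosedBox A = Σ (Term C 0 0) (λ r → [] ⨾ [] ⊢ box r ∶ □ A)

  ⟦_⟧ : Ty → Set
  ⟦ o ⟧     = Bool
  ⟦ N ⟧     = ℕ
  ⟦ A ⇒ B ⟧ = ⟦ A ⟧ → ⟦ B ⟧
  ⟦ □ A ⟧   = ClosedBox A × ⟦ A ⟧

  hd : ∀ {A} → ⟦ □ A ⟧ → ClosedBox A
  hd = proj₁

  -- valuations ς with Γ ⊢ ς (dom ς = dom Γ is built into the indexing)
  Valuation : ∀ {u a} → Vec Ty u → Vec Ty a → Set
  Valuation {u} {a} Δ Γ =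
    ((i : Fin u) → ⟦ □ (lookup Δ i) ⟧) × ((j : Fin a) → ⟦ lookup Γ j ⟧)

  ς𝕏 : ∀ {u a} (Δ : Vec Ty u) (Γ : Vec Ty a) → Valuation Δ Γ → Subst C u 0
  ς𝕏 Δ Γ ς i = proj₁ (hd (proj₁ ς i))

-- The proof is the usual syntactic substitution lemma for the modal
-- calculus.  First, free atoms are tracked through renaming and through
-- unknowns-substitution: a substitution only inserts terms without atoms, so
-- fa (r ⟨ θ ⟩) = fa r, which keeps the side condition of (□I) intact.  Next,
-- typing is stable under renamings of atoms and unknowns that respect the
-- contexts (this gives the weakening needed to push a substitution under a
-- letbox binder and to move a closed term into an arbitrary atom context).
-- The substitution lemma then says that if every unknown X_i : □ A_i is sent
-- to a term of type A_i in Δ' ⨾ [], the whole derivation is transported to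
-- Δ'.  Finally, a valuation ς supplies for each unknown a closed term □ r
-- with ∅ ⊢ □ r : □ A, whence ∅ ⊢ r : A by inversion of (□I); the theorem
-- is the substitution lemma applied to ς𝕏 with Δ' = [].

module Submission where

open import Defs
open import Data.Nat using (ℕ; suc)
open import Data.Fin using (Fin; zero; suc)
open import Data.Vec using (Vec; []; _∷_; lookup)
open import Data.List using (List; []; _∷_; _++_; map)
open import Data.List.Properties using (map-++)
open import Data.Product using (proj₁; proj₂)
open import Function using (id)
open import Relation.Binary.PropositionalEquality
  using (_≡_; refl; sym; trans; cong; cong₂; subst)

strip-map : ∀ {n m} (g : Fin n → Fin m) (xs : List (Fin (suc n))) →
  strip (map (lift g) xs) ≡ map g (strip xs)
strip-map g []           = refl
strip-map g (zero  ∷ xs) = strip-map g xs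
strip-map g (suc j ∷ xs) = cong (g j ∷_) (strip-map g xs)

fa-ren : ∀ {C u u' a a'} (f : Fin u → Fin u') (g : Fin a → Fin a')
  (r : Term C u a) → fa (ren f g r) ≡ map g (fa r)
fa-ren f g (con c)      = refl
fa-ren f g (atm j)      = refl
fa-ren f g (unk i)      = refl
fa-ren f g (lam A r)    =
  trans (cong strip (fa-ren f (lift g) r)) (strip-map g (fa r))
fa-ren f g (app r s)    =
  trans (cong₂ _++_ (fa-ren f g r) (fa-ren f g s)) (sym (map-++ g (fa r) (fa s)))
fa-ren f g (box r)      = fa-ren f g r
fa-ren f g (letbox s r) =
  trans (cong₂ _++_ (fa-ren (lift f) g r) (fa-ren f g s)) (sym (map-++ g (fa r) (fa s)))

fa-closed : ∀ {C u} (r : Term C u 0) → fa r ≡ []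
fa-closed r = no-atoms (fa r)
  where
  no-atoms : (xs : List (Fin 0)) → xs ≡ []
  no-atoms []       = refl
  no-atoms (() ∷ _)

-- Unknowns-substitution does not change the free atoms, since it only
-- inserts terms without atoms.
fa-subst : ∀ {C u m a} (r : Term C u a) (θ : Subst C u m) → fa (r ⟨ θ ⟩) ≡ fa r
fa-subst (con c)      θ = refl
fa-subst (atm j)      θ = refl
fa-subst (unk i)      θ =
  trans (fa-ren id noAtoms (θ i)) (cong (map noAtoms) (fa-closed (θ i)))
fa-subst (lam A r)    θ = cong strip (fa-subst r θ)
fa-subst (app r s)    θ = cong₂ _++_ (fa-subst r θ) (fa-subst s θ)
fa-subst (box r)      θ = fa-subst r θ
fa-subst (letbox s r) θ = cong₂ _++_ (fa-subst r (liftS θ)) (fa-subst s θ)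

Respects : ∀ {n m} → Vec Ty n → Vec Ty m → (Fin n → Fin m) → Set
Respects Γ Γ' g = ∀ j → lookup Γ' (g j) ≡ lookup Γ j

lift-respects : ∀ {n m} {Γ : Vec Ty n} {Γ' : Vec Ty m} {A : Ty}
  (g : Fin n → Fin m) → Respects Γ Γ' g → Respects (A ∷ Γ) (A ∷ Γ') (lift g)
lift-respects g p zero    = refl
lift-respects g p (suc j) = p j

module _ {C : Set} (type : C → Ty) where

  _⨾_⊢ₜ_∶_ : ∀ {u a} → Vec Ty u → Vec Ty a → Term C u a → Ty → Set
  _⨾_⊢ₜ_∶_ = _⨾_⊢_∶_ type

  -- Renaming lemma: typing is preserved by context-respecting renamings of
  -- unknowns and atoms.  Free atoms are renamed along, so (□I) survives.
  ren-typing : ∀ {u u' a a'} {Δ : Vec Ty u} {Δ' : Vec Ty u'}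
    {Γ : Vec Ty a} {Γ' : Vec Ty a'}
    (f : Fin u → Fin u') (g : Fin a → Fin a') →
    Respects Δ Δ' f → Respects Γ Γ' g →
    ∀ {r A} → Δ ⨾ Γ ⊢ₜ r ∶ A → Δ' ⨾ Γ' ⊢ₜ ren f g r ∶ A
  ren-typing f g pf pg (hyp j)   = subst (_ ⨾ _ ⊢ₜ _ ∶_) (pg j) (hyp (g j))
  ren-typing f g pf pg (const c) = const c
  ren-typing f g pf pg (→I d)    =
    →I (ren-typing f (lift g) pf (lift-respects g pg) d)
  ren-typing f g pf pg (→E d e)  = →E (ren-typing f g pf pg d) (ren-typing f g pf pg e)
  ren-typing f g pf pg (□I {r = r} d closed) =
    □I (ren-typing f g pf pg d) (trans (fa-ren f g r) (cong (map g) closed))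
  ren-typing f g pf pg (□E d e)  =
    □E (ren-typing f g pf pg d) (ren-typing (lift f) g (lift-respects f pf) pg e)
  ren-typing f g pf pg (ext i)   = subst (_ ⨾ _ ⊢ₜ _ ∶_) (pf i) (ext (f i))

  weaken-atoms : ∀ {u a} {Δ : Vec Ty u} {Γ : Vec Ty a} {r : Term C u 0} {A : Ty} →
    Δ ⨾ [] ⊢ₜ r ∶ A → Δ ⨾ Γ ⊢ₜ ren id noAtoms r ∶ A
  weaken-atoms = ren-typing id noAtoms (λ _ → refl) (λ ())

  _⊩_∶_ : ∀ {u m} → Vec Ty m → Subst C u m → Vec Ty u → Set
  Δ' ⊩ θ ∶ Δ = ∀ i → Δ' ⨾ [] ⊢ₜ θ i ∶ lookup Δ i

  liftS-typing : ∀ {u m} {Δ : Vec Ty u} {Δ' : Vec Ty m} {A : Ty} {θ : Subst C u m} →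
    Δ' ⊩ θ ∶ Δ → (A ∷ Δ') ⊩ liftS θ ∶ (A ∷ Δ)
  liftS-typing p zero    = ext zero
  liftS-typing p (suc i) = ren-typing suc id (λ _ → refl) (λ ()) (p i)

  subst-typing : ∀ {u m a} {Δ : Vec Ty u} {Δ' : Vec Ty m} {Γ : Vec Ty a}
    {θ : Subst C u m} → Δ' ⊩ θ ∶ Δ →
    ∀ {r A} → Δ ⨾ Γ ⊢ₜ r ∶ A → Δ' ⨾ Γ ⊢ₜ r ⟨ θ ⟩ ∶ A
  subst-typing p (hyp j)   = hyp j
  subst-typing p (const c) = const c
  subst-typing p (→I d)    = →I (subst-typing p d)
  subst-typing p (→E d e)  = →E (subst-typing p d) (subst-typing p e)
  subst-typing {θ = θ} p (□I {r = r} d closed) =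
    □I (subst-typing p d) (trans (fa-subst r θ) closed)
  subst-typing p (□E d e)  = □E (subst-typing p d) (subst-typing (liftS-typing p) e)
  subst-typing p (ext i)   = weaken-atoms (p i)

  unbox-typing : ∀ {u a} {Δ : Vec Ty u} {Γ : Vec Ty a} {r : Term C u a} {A : Ty} →
    Δ ⨾ Γ ⊢ₜ box r ∶ □ A → Δ ⨾ Γ ⊢ₜ r ∶ A
  unbox-typing (□I d _) = d

  ς𝕏-typing : ∀ {u a} (Δ : Vec Ty u) (Γ : Vec Ty a) (ς : Valuation type Δ Γ) →
    [] ⊩ ς𝕏 type Δ Γ ς ∶ Δ
  ς𝕏-typing Δ Γ ς i = unbox-typing (proj₂ (hd type (proj₁ ς i)))

proposition3p13 : {C : Set} (type : C → Ty) {u a : ℕ}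
    (Δ : Vec Ty u) (Γ : Vec Ty a) (r : Term C u a) (A : Ty)
    (ς : Valuation type Δ Γ) →
    _⨾_⊢_∶_ type Δ Γ r A →
    _⨾_⊢_∶_ type [] Γ (r ⟨ ς𝕏 type Δ Γ ς ⟩) A
proposition3p13 type Δ Γ r A ς d = subst-typing type (ς𝕏-typing type Δ Γ ς) d
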